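{- Let $(\mu_\circ,\eta_\circ,\delta_\circ,\epsilon_\circ)$ and $(\mu_\bullet,\eta_\bullet,\delta_\bullet,\epsilon_\bullet)$ form a GHZ/W-pair on an object $Q$ of a symmetric monoidal category $\mathbf V$, and assume $\{\eta_\bullet,\tau\circ\eta_\bullet\}$ is a plugging set for $Q$. Then for every $\psi:I\to Q$, $$\Phi_\psi\circ\eta_\bullet=(\epsilon_\bullet\circ\tau\circ\psi)\cdot\eta_\bullet,$$ where $\Phi_\psi:=\mu_\circ\circ(1_Q\otimes\psi)$.
   Context: Let $(\mathbf V,\otimes,I,\sigma)$ be a symmetric monoidal category; scalars are morphisms $I\to I$ and $s\cdot f$ denotes $s\otimes f$ with $I\otimes X\cong X$. A commutative Frobenius algebra (CFA) on $Q$ is a commutative monoid $(Q,\mu,\eta)$ and cocommutative comonoid $(Q,\delta,\epsilon)$ with $(1\otimes\mu)(\delta\otimes 1)=\delta\mu=(\mu\otimes1)(1\otimes\delta)$. It is special if $\mu\circ\delta=1_Q$, and anti-special if $c\cdot(\mu\circ\delta)=(\mu\circ\delta\circ\eta)\circ(\epsilon\circ\mu\circ\delta)$ where $c=\epsilon\circ\mu\circ\delta\circ\eta$. A GHZ-structure is a special CFA $(\mu_\circ,\eta_\circ,\delta_\circ,\epsilon_\circ)$, a W-structure an anti-special CFA $(\mu_\bullet,\eta_\bullet,\delta_\bullet,\epsilon_\bullet)$, both on $Q$. Define $\tau:=(\epsilon_\bullet\mu_\bullet\otimes 1_Q)\circ(1_Q\otimes\delta_\circ\eta_\circ):Q\to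 Q$. They form a GHZ/W-pair if: ($\alpha$) $\tau=(\epsilon_\circ\mu_\circ\otimes 1_Q)\circ(1_Q\otimes\delta_\bullet\eta_\bullet)$; ($\beta$) $\delta_\circ\circ\eta_\bullet=\eta_\bullet\otimes\eta_\bullet$; ($\gamma$) $\delta_\circ\circ\tau=(\tau\otimes\tau)\circ\delta_\circ$; ($\xi$) $(\epsilon_\bullet\mu_\bullet\delta_\bullet\eta_\bullet)\cdot(\tau\circ\eta_\bullet)=\mu_\bullet\circ\delta_\bullet\circ\eta_\bullet$. A set of points $\{\psi_i:I\to Q\}$ is a plugging set if for all objects $A$ and $f,g:Q\to A$, $f=g$ iff $f\circ\psi_i=g\circ\psi_i$ for all $i$. -}

module Defs where

open import Level using (Level; suc; _⊔_)
open import Relation.Binary.Structures using (IsEquivalence)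
open import Data.Product using (_×_)

record SymmetricMonoidalCategory (o ℓ e : Level) : Set (suc (o ⊔ ℓ ⊔ e)) where
  infixr 9 _∘_
  infixr 10 _⊗₁_
  infixr 10 _⊗₀_
  infix  4 _≈_
  field
    Obj  : Set o
    _⇒_  : Obj → Obj → Set ℓ
    _≈_  : ∀ {A B} → A ⇒ B → A ⇒ B → Set e
    ≈-equiv : ∀ {A B} → IsEquivalence (_≈_ {A} {B})
    id   : ∀ {A} → A ⇒ A
    _∘_  : ∀ {A B C} → B ⇒ C → A ⇒ B → A ⇒ C
    assoc : ∀ {A B C D} {f : A ⇒ B} {g : B ⇒ C} {h : C ⇒ D} →
            (h ∘ g) ∘ f ≈ h ∘ (g ∘ f)
    identityˡ : ∀ {A B} {f : A ⇒ B} → id ∘ f ≈ f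
    identityʳ : ∀ {A B} {f : A ⇒ B} → f ∘ id ≈ f
    ∘-resp-≈ : ∀ {A B C} {f h : B ⇒ C} {g i : A ⇒ B} →
               f ≈ h → g ≈ i → f ∘ g ≈ h ∘ i
    _⊗₀_ : Obj → Obj → Obj
    _⊗₁_ : ∀ {A B C D} → A ⇒ B → C ⇒ D → (A ⊗₀ C) ⇒ (B ⊗₀ D)
    unit : Obj
    ⊗-identity : ∀ {A B} → id {A} ⊗₁ id {B} ≈ id
    ⊗-homomorphism : ∀ {A B C D E F} {f : A ⇒ B} {g : B ⇒ C} {h : D ⇒ E} {k : E ⇒ F} →
                     (g ∘ f) ⊗₁ (k ∘ h) ≈ (g ⊗₁ k) ∘ (f ⊗₁ h)
    ⊗-resp-≈ : ∀ {A B C D} {f g : A ⇒ B} {h k : C ⇒ D} →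
               f ≈ g → h ≈ k → f ⊗₁ h ≈ g ⊗₁ k
    unitorˡ⇒ : ∀ {A} → (unit ⊗₀ A) ⇒ A
    unitorˡ⇐ : ∀ {A} → A ⇒ (unit ⊗₀ A)
    unitorʳ⇒ : ∀ {A} → (A ⊗₀ unit) ⇒ A
    unitorʳ⇐ : ∀ {A} → A ⇒ (A ⊗₀ unit)
    associator⇒ : ∀ {A B C} → ((A ⊗₀ B) ⊗₀ C) ⇒ (A ⊗₀ (B ⊗₀ C))
    associator⇐ : ∀ {A B C} → (A ⊗₀ (B ⊗₀ C)) ⇒ ((A ⊗₀ B) ⊗₀ C)
    unitorˡ-isoˡ : ∀ {A} → unitorˡ⇐ ∘ unitorˡ⇒ {A} ≈ id
    unitorˡ-isoʳ : ∀ {A} → unitorˡ⇒ ∘ unitorˡ⇐ {A} ≈ id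
    unitorʳ-isoˡ : ∀ {A} → unitorʳ⇐ ∘ unitorʳ⇒ {A} ≈ id
    unitorʳ-isoʳ : ∀ {A} → unitorʳ⇒ ∘ unitorʳ⇐ {A} ≈ id
    associator-isoˡ : ∀ {A B C} → associator⇐ ∘ associator⇒ {A} {B} {C} ≈ id
    associator-isoʳ : ∀ {A B C} → associator⇒ ∘ associator⇐ {A} {B} {C} ≈ id
    unitorˡ-natural : ∀ {A B} {f : A ⇒ B} → unitorˡ⇒ ∘ (id ⊗₁ f) ≈ f ∘ unitorˡ⇒
    unitorʳ-natural : ∀ {A B} {f : A ⇒ B} → unitorʳ⇒ ∘ (f ⊗₁ id) ≈ f ∘ unitorʳ⇒
    associator-natural : ∀ {A B C D E F} {f : A ⇒ B} {g : C ⇒ D} {h : E ⇒ F} →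
                         associator⇒ ∘ ((f ⊗₁ g) ⊗₁ h) ≈ (f ⊗₁ (g ⊗₁ h)) ∘ associator⇒
    triangle : ∀ {A B} → (id {A} ⊗₁ unitorˡ⇒ {B}) ∘ associator⇒ ≈ unitorʳ⇒ ⊗₁ id
    pentagon : ∀ {A B C D} →
               (id {A} ⊗₁ associator⇒ {B} {C} {D}) ∘ associator⇒ ∘ (associator⇒ ⊗₁ id)
               ≈ associator⇒ ∘ associator⇒
    braiding : ∀ {A B} → (A ⊗₀ B) ⇒ (B ⊗₀ A)
    braiding-natural : ∀ {A B C D} {f : A ⇒ B} {g : C ⇒ D} →
                       braiding ∘ (f ⊗₁ g) ≈ (g ⊗₁ f) ∘ braiding
    commutative : ∀ {A B} → braiding {B} {A} ∘ braiding {A} {B} ≈ id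
    hexagon : ∀ {A B C} →
              associator⇒ {B} {C} {A} ∘ braiding {A} {B ⊗₀ C} ∘ associator⇒
              ≈ (id ⊗₁ braiding) ∘ associator⇒ ∘ (braiding ⊗₁ id)

module _ {o ℓ e : Level} (V : SymmetricMonoidalCategory o ℓ e) where
  open SymmetricMonoidalCategory V

  scalarMul : ∀ {X Y} → unit ⇒ unit → X ⇒ Y → X ⇒ Y
  scalarMul s f = unitorˡ⇒ ∘ (s ⊗₁ f) ∘ unitorˡ⇐

  record CFA (Q : Obj) : Set (ℓ ⊔ e) where
    field
      μ : (Q ⊗₀ Q) ⇒ Q
      η : unit ⇒ Q
      δ : Q ⇒ (Q ⊗₀ Q)
      ε : Q ⇒ unit
      μ-assoc : μ ∘ (μ ⊗₁ id) ≈ μ ∘ (id ⊗₁ μ) ∘ associator⇒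
      μ-unitˡ : μ ∘ (η ⊗₁ id) ≈ unitorˡ⇒
      μ-unitʳ : μ ∘ (id ⊗₁ η) ≈ unitorʳ⇒
      μ-comm  : μ ∘ braiding ≈ μ
      δ-coassoc : associator⇒ ∘ (δ ⊗₁ id) ∘ δ ≈ (id ⊗₁ δ) ∘ δ
      δ-counitˡ : (ε ⊗₁ id) ∘ δ ≈ unitorˡ⇐
      δ-counitʳ : (id ⊗₁ ε) ∘ δ ≈ unitorʳ⇐
      δ-cocomm  : braiding ∘ δ ≈ δ
      frobeniusˡ : (id ⊗₁ μ) ∘ associator⇒ ∘ (δ ⊗₁ id) ≈ δ ∘ μ
      frobeniusʳ : (μ ⊗₁ id) ∘ associator⇐ ∘ (id ⊗₁ δ) ≈ δ ∘ μ

  module _ {Q : Obj} (F : CFA Q) where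
    open CFA F
    Special : Set e
    Special = μ ∘ δ ≈ id

    AntiSpecial : Set e
    AntiSpecial = scalarMul (ε ∘ μ ∘ δ ∘ η) (μ ∘ δ) ≈ (μ ∘ δ ∘ η) ∘ (ε ∘ μ ∘ δ)

  tau : ∀ {Q} → CFA Q → CFA Q → Q ⇒ Q
  tau G W = unitorˡ⇒ ∘ ((CFA.ε W ∘ CFA.μ W) ⊗₁ id) ∘ associator⇐
            ∘ (id ⊗₁ (CFA.δ G ∘ CFA.η G)) ∘ unitorʳ⇐

  -- GHZ/W-pair: G is the GHZ-structure (∘), W the W-structure (•)
  record GHZWPair {Q : Obj} (G W : CFA Q) : Set e where
    field
      ghz-special : Special G
      w-antispecial : AntiSpecial W
      pair-α : tau G W ≈ tau W G
      pair-β : CFA.δ G ∘ CFA.η W ≈ (CFA.η W ⊗₁ CFA.η W) ∘ unitorˡ⇐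
      pair-γ : CFA.δ G ∘ tau G W ≈ (tau G W ⊗₁ tau G W) ∘ CFA.δ G
      pair-ξ : scalarMul (CFA.ε W ∘ CFA.μ W ∘ CFA.δ W ∘ CFA.η W) (tau G W ∘ CFA.η W)
               ≈ CFA.μ W ∘ CFA.δ W ∘ CFA.η W

  PluggingSet₂ : ∀ {Q} → unit ⇒ Q → unit ⇒ Q → Set (o ⊔ ℓ ⊔ e)
  PluggingSet₂ {Q} ψ₁ ψ₂ = ∀ {A} (f g : Q ⇒ A) →
    (f ≈ g → (f ∘ ψ₁ ≈ g ∘ ψ₁) × (f ∘ ψ₂ ≈ g ∘ ψ₂)) ×
    ((f ∘ ψ₁ ≈ g ∘ ψ₁) × (f ∘ ψ₂ ≈ g ∘ ψ₂) → f ≈ g)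

  Phi : ∀ {Q} → CFA Q → unit ⇒ Q → Q ⇒ Q
  Phi G ψ = CFA.μ G ∘ (id ⊗₁ ψ) ∘ unitorʳ⇐

-- Φ_ψ ∘ η• = μ∘ ∘ (η• ⊗ ψ) = Φ_{η•} ∘ ψ by commutativity of μ∘. Axiom (β) says that η• is
-- copyable for δ∘, so the Frobenius law gives δ∘ ∘ Φ_{η•} = Φ_{η•} ⊗ η•, and applying the counit
-- ε∘ shows that Φ_{η•} has rank one: Φ_{η•} ∘ x = (ε∘ ∘ Φ_{η•} ∘ x) · η•. Finally the counit law of
-- the W-structure gives ε∘ ∘ Φ_{η•} = ε• ∘ τ′, where τ′ is τ with the two algebras exchanged, and
-- τ′ = τ is axiom (α).
module Submission where

open import Defs
open import Level using (Level)
open import Relation.Binary.Bundles using (Setoid)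
import Relation.Binary.Reasoning.Setoid as SetoidReasoning

module MonoidalCoherence {o ℓ e : Level} (V : SymmetricMonoidalCategory o ℓ e) where
  open SymmetricMonoidalCategory V

  hom-setoid : Obj → Obj → Setoid ℓ e
  hom-setoid A B = record { Carrier = A ⇒ B ; _≈_ = _≈_ ; isEquivalence = ≈-equiv }

  module HomReasoning {A B : Obj} where
    open Setoid (hom-setoid A B) public using (refl; sym; trans)
    open SetoidReasoning (hom-setoid A B) public

  open HomReasoning

  infixr 4 _⟩∘⟨_ refl⟩∘⟨_
  infixl 5 _⟩∘⟨refl

  _⟩∘⟨_ : ∀ {A B C} {f h : B ⇒ C} {g i : A ⇒ B} → f ≈ h → g ≈ i → f ∘ g ≈ h ∘ i
  _⟩∘⟨_ = ∘-resp-≈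

  refl⟩∘⟨_ : ∀ {A B C} {f : B ⇒ C} {g i : A ⇒ B} → g ≈ i → f ∘ g ≈ f ∘ i
  refl⟩∘⟨ p = refl ⟩∘⟨ p

  _⟩∘⟨refl : ∀ {A B C} {f h : B ⇒ C} {g : A ⇒ B} → f ≈ h → f ∘ g ≈ h ∘ g
  p ⟩∘⟨refl = p ⟩∘⟨ refl

  pullˡ : ∀ {A B C D} {a : C ⇒ D} {b : B ⇒ C} {c : B ⇒ D} {f : A ⇒ B} →
          a ∘ b ≈ c → a ∘ b ∘ f ≈ c ∘ f
  pullˡ p = trans (sym assoc) (p ⟩∘⟨refl)

  pushˡ : ∀ {A B C D} {a : C ⇒ D} {b : B ⇒ C} {c : B ⇒ D} {f : A ⇒ B} →
          c ≈ a ∘ b → c ∘ f ≈ a ∘ b ∘ f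
  pushˡ p = sym (pullˡ (sym p))

  cancelʳ : ∀ {A B C} {s : A ⇒ B} {r : B ⇒ A} {f g : B ⇒ C} →
            s ∘ r ≈ id → f ∘ s ≈ g ∘ s → f ≈ g
  cancelʳ {s = s} {r} {f} {g} sr fs≈gs = begin
    f           ≈⟨ identityʳ ⟨
    f ∘ id      ≈⟨ refl⟩∘⟨ sr ⟨
    f ∘ s ∘ r   ≈⟨ pullˡ fs≈gs ⟩
    (g ∘ s) ∘ r ≈⟨ assoc ⟩
    g ∘ s ∘ r   ≈⟨ refl⟩∘⟨ sr ⟩
    g ∘ id      ≈⟨ identityʳ ⟩
    g           ∎

  cancelˡ : ∀ {A B C} {s : B ⇒ C} {r : C ⇒ B} {f g : A ⇒ B} →
            r ∘ s ≈ id → s ∘ f ≈ s ∘ g → f ≈ g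
  cancelˡ {s = s} {r} {f} {g} rs sf≈sg = begin
    f           ≈⟨ identityˡ ⟨
    id ∘ f      ≈⟨ rs ⟩∘⟨refl ⟨
    (r ∘ s) ∘ f ≈⟨ assoc ⟩
    r ∘ s ∘ f   ≈⟨ refl⟩∘⟨ sf≈sg ⟩
    r ∘ s ∘ g   ≈⟨ pullˡ rs ⟩
    id ∘ g      ≈⟨ identityˡ ⟩
    g           ∎

  inverse-square : ∀ {A A′ B B′} {i : B ⇒ B′} {i⁻¹ : B′ ⇒ B} {j : A ⇒ A′} {j⁻¹ : A′ ⇒ A}
                   {g : A ⇒ B} {f : A′ ⇒ B′} →
                   i⁻¹ ∘ i ≈ id → j ∘ j⁻¹ ≈ id → i ∘ g ≈ f ∘ j → g ∘ j⁻¹ ≈ i⁻¹ ∘ f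
  inverse-square {i = i} {i⁻¹} {j} {j⁻¹} {g} {f} ii jj sq = begin
    g ∘ j⁻¹               ≈⟨ identityˡ ⟨
    id ∘ g ∘ j⁻¹          ≈⟨ ii ⟩∘⟨refl ⟨
    (i⁻¹ ∘ i) ∘ g ∘ j⁻¹   ≈⟨ assoc ⟩
    i⁻¹ ∘ i ∘ g ∘ j⁻¹     ≈⟨ refl⟩∘⟨ pullˡ sq ⟩
    i⁻¹ ∘ (f ∘ j) ∘ j⁻¹   ≈⟨ refl⟩∘⟨ assoc ⟩
    i⁻¹ ∘ f ∘ j ∘ j⁻¹     ≈⟨ refl⟩∘⟨ refl⟩∘⟨ jj ⟩
    i⁻¹ ∘ f ∘ id          ≈⟨ refl⟩∘⟨ identityʳ ⟩
    i⁻¹ ∘ f               ∎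

  id⊗-homomorphism : ∀ {A B C D} {f : B ⇒ C} {g : A ⇒ B} →
                     id {D} ⊗₁ (f ∘ g) ≈ (id ⊗₁ f) ∘ (id ⊗₁ g)
  id⊗-homomorphism = trans (⊗-resp-≈ (sym identityˡ) refl) ⊗-homomorphism

  ⊗id-homomorphism : ∀ {A B C D} {f : B ⇒ C} {g : A ⇒ B} →
                     (f ∘ g) ⊗₁ id {D} ≈ (f ⊗₁ id) ∘ (g ⊗₁ id)
  ⊗id-homomorphism = trans (⊗-resp-≈ refl (sym identityˡ)) ⊗-homomorphism

  ⊗-inverse : ∀ {A B C D} {f : A ⇒ B} {f⁻¹ : B ⇒ A} {g : C ⇒ D} {g⁻¹ : D ⇒ C} →
              f⁻¹ ∘ f ≈ id → g⁻¹ ∘ g ≈ id → (f⁻¹ ⊗₁ g⁻¹) ∘ (f ⊗₁ g) ≈ id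
  ⊗-inverse ff gg = trans (sym ⊗-homomorphism) (trans (⊗-resp-≈ ff gg) ⊗-identity)

  unitorʳ⇐-natural : ∀ {A B} {f : A ⇒ B} → unitorʳ⇐ ∘ f ≈ (f ⊗₁ id) ∘ unitorʳ⇐
  unitorʳ⇐-natural = sym (inverse-square unitorʳ-isoˡ unitorʳ-isoʳ unitorʳ-natural)

  associator⇐-natural : ∀ {A B C D E F} {f : A ⇒ B} {g : C ⇒ D} {h : E ⇒ F} →
                        associator⇐ ∘ (f ⊗₁ (g ⊗₁ h)) ≈ ((f ⊗₁ g) ⊗₁ h) ∘ associator⇐
  associator⇐-natural = sym (inverse-square associator-isoˡ associator-isoʳ associator-natural)

  unit⊗-injective : ∀ {A B} {f g : A ⇒ B} → id {unit} ⊗₁ f ≈ id ⊗₁ g → f ≈ g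
  unit⊗-injective {f = f} {g} p = cancelʳ unitorˡ-isoʳ (begin
    f ∘ unitorˡ⇒         ≈⟨ unitorˡ-natural ⟨
    unitorˡ⇒ ∘ (id ⊗₁ f) ≈⟨ refl⟩∘⟨ p ⟩
    unitorˡ⇒ ∘ (id ⊗₁ g) ≈⟨ unitorˡ-natural ⟩
    g ∘ unitorˡ⇒         ∎)

  ⊗unit-injective : ∀ {A B} {f g : A ⇒ B} → f ⊗₁ id {unit} ≈ g ⊗₁ id → f ≈ g
  ⊗unit-injective {f = f} {g} p = cancelʳ unitorʳ-isoʳ (begin
    f ∘ unitorʳ⇒         ≈⟨ unitorʳ-natural ⟨
    unitorʳ⇒ ∘ (f ⊗₁ id) ≈⟨ refl⟩∘⟨ p ⟩
    unitorʳ⇒ ∘ (g ⊗₁ id) ≈⟨ unitorʳ-natural ⟩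
    g ∘ unitorʳ⇒         ∎)

  triangle-inverse : ∀ {A B} → associator⇐ ∘ (id {A} ⊗₁ unitorˡ⇐ {B}) ≈ unitorʳ⇐ ⊗₁ id
  triangle-inverse = cancelˡ (⊗-inverse unitorʳ-isoˡ identityˡ) (begin
    (unitorʳ⇒ ⊗₁ id) ∘ associator⇐ ∘ (id ⊗₁ unitorˡ⇐)              ≈⟨ triangle ⟩∘⟨refl ⟨
    ((id ⊗₁ unitorˡ⇒) ∘ associator⇒) ∘ associator⇐ ∘ (id ⊗₁ unitorˡ⇐) ≈⟨ assoc ⟩
    (id ⊗₁ unitorˡ⇒) ∘ associator⇒ ∘ associator⇐ ∘ (id ⊗₁ unitorˡ⇐)   ≈⟨ refl⟩∘⟨ pullˡ associator-isoʳ ⟩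
    (id ⊗₁ unitorˡ⇒) ∘ id ∘ (id ⊗₁ unitorˡ⇐)                          ≈⟨ refl⟩∘⟨ identityˡ ⟩
    (id ⊗₁ unitorˡ⇒) ∘ (id ⊗₁ unitorˡ⇐)                               ≈⟨ ⊗-inverse identityˡ unitorˡ-isoʳ ⟩
    id                                                                ≈⟨ ⊗-inverse unitorʳ-isoʳ identityˡ ⟨
    (unitorʳ⇒ ⊗₁ id) ∘ (unitorʳ⇐ ⊗₁ id)                               ∎)

  -- Kelly: tensored on the left with the unit, this follows from the pentagon and the triangle.
  unitorˡ-associator : ∀ {A B} → unitorˡ⇒ {A ⊗₀ B} ∘ associator⇒ ≈ unitorˡ⇒ ⊗₁ id
  unitorˡ-associator {A} {B} = unit⊗-injective (cancelʳ associators-inverse (begin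
    (id ⊗₁ (unitorˡ⇒ ∘ associator⇒)) ∘ associator⇒ ∘ (associator⇒ ⊗₁ id)
      ≈⟨ id⊗-homomorphism ⟩∘⟨refl ⟩
    ((id ⊗₁ unitorˡ⇒) ∘ (id ⊗₁ associator⇒)) ∘ associator⇒ ∘ (associator⇒ ⊗₁ id)
      ≈⟨ assoc ⟩
    (id ⊗₁ unitorˡ⇒) ∘ (id ⊗₁ associator⇒) ∘ associator⇒ ∘ (associator⇒ ⊗₁ id)
      ≈⟨ refl⟩∘⟨ pentagon ⟩
    (id ⊗₁ unitorˡ⇒) ∘ associator⇒ ∘ associator⇒
      ≈⟨ pullˡ triangle ⟩
    (unitorʳ⇒ ⊗₁ id) ∘ associator⇒
      ≈⟨ ⊗-resp-≈ refl ⊗-identity ⟩∘⟨refl ⟨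
    (unitorʳ⇒ ⊗₁ (id ⊗₁ id)) ∘ associator⇒
      ≈⟨ associator-natural ⟨
    associator⇒ ∘ ((unitorʳ⇒ ⊗₁ id) ⊗₁ id)
      ≈⟨ refl⟩∘⟨ ⊗-resp-≈ triangle refl ⟨
    associator⇒ ∘ (((id ⊗₁ unitorˡ⇒) ∘ associator⇒) ⊗₁ id)
      ≈⟨ refl⟩∘⟨ ⊗id-homomorphism ⟩
    associator⇒ ∘ ((id ⊗₁ unitorˡ⇒) ⊗₁ id) ∘ (associator⇒ ⊗₁ id)
      ≈⟨ pullˡ associator-natural ⟩
    ((id ⊗₁ (unitorˡ⇒ ⊗₁ id)) ∘ associator⇒) ∘ (associator⇒ ⊗₁ id)
      ≈⟨ assoc ⟩
    (id ⊗₁ (unitorˡ⇒ ⊗₁ id)) ∘ associator⇒ ∘ (associator⇒ ⊗₁ id) ∎))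
    where
    associators-inverse : (associator⇒ {unit} {unit ⊗₀ A} {B} ∘ (associator⇒ ⊗₁ id))
                          ∘ ((associator⇐ ⊗₁ id) ∘ associator⇐) ≈ id
    associators-inverse = begin
      (associator⇒ ∘ (associator⇒ ⊗₁ id)) ∘ (associator⇐ ⊗₁ id) ∘ associator⇐
        ≈⟨ assoc ⟩
      associator⇒ ∘ (associator⇒ ⊗₁ id) ∘ (associator⇐ ⊗₁ id) ∘ associator⇐
        ≈⟨ refl⟩∘⟨ pullˡ (⊗-inverse associator-isoʳ identityˡ) ⟩
      associator⇒ ∘ id ∘ associator⇐
        ≈⟨ refl⟩∘⟨ identityˡ ⟩
      associator⇒ ∘ associator⇐
        ≈⟨ associator-isoʳ ⟩
      id ∎

  unitorˡ-unit⊗ : ∀ {A} → unitorˡ⇒ {unit ⊗₀ A} ≈ id ⊗₁ unitorˡ⇒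
  unitorˡ-unit⊗ = cancelˡ unitorˡ-isoˡ (sym unitorˡ-natural)

  unitorˡ≈unitorʳ : unitorˡ⇒ {unit} ≈ unitorʳ⇒
  unitorˡ≈unitorʳ = ⊗unit-injective (begin
    unitorˡ⇒ ⊗₁ id                 ≈⟨ unitorˡ-associator ⟨
    unitorˡ⇒ ∘ associator⇒         ≈⟨ unitorˡ-unit⊗ ⟩∘⟨refl ⟩
    (id ⊗₁ unitorˡ⇒) ∘ associator⇒ ≈⟨ triangle ⟩
    unitorʳ⇒ ⊗₁ id                 ∎)

  unitorˡ⇐≈unitorʳ⇐ : unitorˡ⇐ {unit} ≈ unitorʳ⇐
  unitorˡ⇐≈unitorʳ⇐ = cancelˡ unitorʳ-isoˡ (begin
    unitorʳ⇒ ∘ unitorˡ⇐ ≈⟨ unitorˡ≈unitorʳ ⟩∘⟨refl ⟨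
    unitorˡ⇒ ∘ unitorˡ⇐ ≈⟨ unitorˡ-isoʳ ⟩
    id                  ≈⟨ unitorʳ-isoʳ ⟨
    unitorʳ⇒ ∘ unitorʳ⇐ ∎)

  -- Tensored on the right with an object, this is the hexagon read through the triangle.
  unitorˡ-braiding : ∀ {A} → unitorˡ⇒ ∘ braiding {A} {unit} ≈ unitorʳ⇒
  unitorˡ-braiding = sym (⊗unit-injective (cancelˡ commutative (begin
    braiding ∘ (unitorʳ⇒ ⊗₁ id)
      ≈⟨ refl⟩∘⟨ triangle ⟨
    braiding ∘ (id ⊗₁ unitorˡ⇒) ∘ associator⇒
      ≈⟨ pullˡ braiding-natural ⟩
    ((unitorˡ⇒ ⊗₁ id) ∘ braiding) ∘ associator⇒
      ≈⟨ (unitorˡ-associator ⟩∘⟨refl) ⟩∘⟨refl ⟨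
    ((unitorˡ⇒ ∘ associator⇒) ∘ braiding) ∘ associator⇒
      ≈⟨ trans assoc assoc ⟩
    unitorˡ⇒ ∘ associator⇒ ∘ braiding ∘ associator⇒
      ≈⟨ refl⟩∘⟨ hexagon ⟩
    unitorˡ⇒ ∘ (id ⊗₁ braiding) ∘ associator⇒ ∘ (braiding ⊗₁ id)
      ≈⟨ pullˡ unitorˡ-natural ⟩
    (braiding ∘ unitorˡ⇒) ∘ associator⇒ ∘ (braiding ⊗₁ id)
      ≈⟨ assoc ⟩
    braiding ∘ unitorˡ⇒ ∘ associator⇒ ∘ (braiding ⊗₁ id)
      ≈⟨ refl⟩∘⟨ pullˡ unitorˡ-associator ⟩
    braiding ∘ (unitorˡ⇒ ⊗₁ id) ∘ (braiding ⊗₁ id)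
      ≈⟨ refl⟩∘⟨ ⊗id-homomorphism ⟨
    braiding ∘ ((unitorˡ⇒ ∘ braiding) ⊗₁ id) ∎)))

  braiding-unit : braiding {unit} {unit} ≈ id
  braiding-unit = cancelˡ unitorʳ-isoˡ (begin
    unitorʳ⇒ ∘ braiding ≈⟨ unitorˡ≈unitorʳ ⟩∘⟨refl ⟨
    unitorˡ⇒ ∘ braiding ≈⟨ unitorˡ-braiding ⟩
    unitorʳ⇒            ≈⟨ identityʳ ⟨
    unitorʳ⇒ ∘ id       ∎)

  id⊗-⊗id-commute : ∀ {A B C D} {f : A ⇒ B} {g : C ⇒ D} →
                    (id ⊗₁ g) ∘ (f ⊗₁ id) ≈ (f ⊗₁ id) ∘ (id ⊗₁ g)
  id⊗-⊗id-commute {f = f} {g} = begin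
    (id ⊗₁ g) ∘ (f ⊗₁ id) ≈⟨ ⊗-homomorphism ⟨
    (id ∘ f) ⊗₁ (g ∘ id)  ≈⟨ ⊗-resp-≈ (trans identityˡ (sym identityʳ)) (trans identityʳ (sym identityˡ)) ⟩
    (f ∘ id) ⊗₁ (id ∘ g)  ≈⟨ ⊗-homomorphism ⟩
    (f ⊗₁ id) ∘ (id ⊗₁ g) ∎

  contract-through-unit : ∀ {X Y} {h : (X ⊗₀ Y) ⇒ unit} {k : unit ⇒ Y} →
    unitorˡ⇒ ∘ (h ⊗₁ id) ∘ associator⇐ ∘ (id ⊗₁ ((k ⊗₁ id) ∘ unitorˡ⇐)) ∘ unitorʳ⇐
    ≈ h ∘ (id ⊗₁ k) ∘ unitorʳ⇐
  contract-through-unit {h = h} {k} = begin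
    unitorˡ⇒ ∘ (h ⊗₁ id) ∘ associator⇐ ∘ (id ⊗₁ ((k ⊗₁ id) ∘ unitorˡ⇐)) ∘ unitorʳ⇐
      ≈⟨ refl⟩∘⟨ refl⟩∘⟨ refl⟩∘⟨ pushˡ id⊗-homomorphism ⟩
    unitorˡ⇒ ∘ (h ⊗₁ id) ∘ associator⇐ ∘ (id ⊗₁ (k ⊗₁ id)) ∘ (id ⊗₁ unitorˡ⇐) ∘ unitorʳ⇐
      ≈⟨ refl⟩∘⟨ refl⟩∘⟨ trans (pullˡ associator⇐-natural) assoc ⟩
    unitorˡ⇒ ∘ (h ⊗₁ id) ∘ ((id ⊗₁ k) ⊗₁ id) ∘ associator⇐ ∘ (id ⊗₁ unitorˡ⇐) ∘ unitorʳ⇐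
      ≈⟨ refl⟩∘⟨ refl⟩∘⟨ refl⟩∘⟨ pullˡ triangle-inverse ⟩
    unitorˡ⇒ ∘ (h ⊗₁ id) ∘ ((id ⊗₁ k) ⊗₁ id) ∘ (unitorʳ⇐ ⊗₁ id) ∘ unitorʳ⇐
      ≈⟨ refl⟩∘⟨ refl⟩∘⟨ pullˡ (sym ⊗id-homomorphism) ⟩
    unitorˡ⇒ ∘ (h ⊗₁ id) ∘ (((id ⊗₁ k) ∘ unitorʳ⇐) ⊗₁ id) ∘ unitorʳ⇐
      ≈⟨ refl⟩∘⟨ pullˡ (sym ⊗id-homomorphism) ⟩
    unitorˡ⇒ ∘ ((h ∘ (id ⊗₁ k) ∘ unitorʳ⇐) ⊗₁ id) ∘ unitorʳ⇐
      ≈⟨ refl⟩∘⟨ unitorʳ⇐-natural ⟨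
    unitorˡ⇒ ∘ unitorʳ⇐ ∘ h ∘ (id ⊗₁ k) ∘ unitorʳ⇐
      ≈⟨ pullˡ (trans (unitorˡ≈unitorʳ ⟩∘⟨refl) unitorʳ-isoʳ) ⟩
    id ∘ h ∘ (id ⊗₁ k) ∘ unitorʳ⇐
      ≈⟨ identityˡ ⟩
    h ∘ (id ⊗₁ k) ∘ unitorʳ⇐ ∎

  scalarMul-resp-≈ : ∀ {A B} {s t : unit ⇒ unit} {f : A ⇒ B} → s ≈ t → scalarMul V s f ≈ scalarMul V t f
  scalarMul-resp-≈ s≈t = refl⟩∘⟨ ⊗-resp-≈ s≈t refl ⟩∘⟨refl

module MultiplicationByPoint {o ℓ e : Level} (V : SymmetricMonoidalCategory o ℓ e)
                             {Q : SymmetricMonoidalCategory.Obj V} (F : CFA V Q) where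
  open SymmetricMonoidalCategory V
  open MonoidalCoherence V
  open HomReasoning
  open CFA F

  Phi∘point : ∀ {p q : unit ⇒ Q} → Phi V F p ∘ q ≈ μ ∘ (q ⊗₁ p) ∘ unitorʳ⇐
  Phi∘point {p} {q} = begin
    (μ ∘ (id ⊗₁ p) ∘ unitorʳ⇐) ∘ q        ≈⟨ trans assoc (refl⟩∘⟨ assoc) ⟩
    μ ∘ (id ⊗₁ p) ∘ unitorʳ⇐ ∘ q          ≈⟨ refl⟩∘⟨ refl⟩∘⟨ unitorʳ⇐-natural ⟩
    μ ∘ (id ⊗₁ p) ∘ (q ⊗₁ id) ∘ unitorʳ⇐  ≈⟨ refl⟩∘⟨ pullˡ (sym ⊗-homomorphism) ⟩
    μ ∘ ((id ∘ q) ⊗₁ (p ∘ id)) ∘ unitorʳ⇐ ≈⟨ refl⟩∘⟨ ⊗-resp-≈ identityˡ identityʳ ⟩∘⟨refl ⟩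
    μ ∘ (q ⊗₁ p) ∘ unitorʳ⇐               ∎

  Phi-points-commute : ∀ {p q : unit ⇒ Q} → Phi V F p ∘ q ≈ Phi V F q ∘ p
  Phi-points-commute {p} {q} = begin
    Phi V F p ∘ q                        ≈⟨ Phi∘point ⟩
    μ ∘ (q ⊗₁ p) ∘ unitorʳ⇐              ≈⟨ μ-comm ⟩∘⟨refl ⟨
    (μ ∘ braiding) ∘ (q ⊗₁ p) ∘ unitorʳ⇐ ≈⟨ trans assoc (refl⟩∘⟨ pullˡ braiding-natural) ⟩
    μ ∘ ((p ⊗₁ q) ∘ braiding) ∘ unitorʳ⇐ ≈⟨ refl⟩∘⟨ assoc ⟩
    μ ∘ (p ⊗₁ q) ∘ braiding ∘ unitorʳ⇐   ≈⟨ refl⟩∘⟨ refl⟩∘⟨ braiding-unit ⟩∘⟨refl ⟩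
    μ ∘ (p ⊗₁ q) ∘ id ∘ unitorʳ⇐         ≈⟨ refl⟩∘⟨ refl⟩∘⟨ identityˡ ⟩
    μ ∘ (p ⊗₁ q) ∘ unitorʳ⇐              ≈⟨ Phi∘point ⟨
    Phi V F q ∘ p                        ∎

  Copyable : unit ⇒ Q → Set e
  Copyable p = δ ∘ p ≈ (p ⊗₁ p) ∘ unitorˡ⇐

  δ∘Phi-copyable : ∀ {p} → Copyable p → δ ∘ Phi V F p ≈ (Phi V F p ⊗₁ p) ∘ unitorʳ⇐
  δ∘Phi-copyable {p} δp = begin
    δ ∘ μ ∘ (id ⊗₁ p) ∘ unitorʳ⇐
      ≈⟨ pullˡ (sym frobeniusʳ) ⟩
    ((μ ⊗₁ id) ∘ associator⇐ ∘ (id ⊗₁ δ)) ∘ (id ⊗₁ p) ∘ unitorʳ⇐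
      ≈⟨ trans assoc (refl⟩∘⟨ assoc) ⟩
    (μ ⊗₁ id) ∘ associator⇐ ∘ (id ⊗₁ δ) ∘ (id ⊗₁ p) ∘ unitorʳ⇐
      ≈⟨ refl⟩∘⟨ refl⟩∘⟨ pullˡ (sym id⊗-homomorphism) ⟩
    (μ ⊗₁ id) ∘ associator⇐ ∘ (id ⊗₁ (δ ∘ p)) ∘ unitorʳ⇐
      ≈⟨ refl⟩∘⟨ refl⟩∘⟨ pushˡ (trans (⊗-resp-≈ refl δp) id⊗-homomorphism) ⟩
    (μ ⊗₁ id) ∘ associator⇐ ∘ (id ⊗₁ (p ⊗₁ p)) ∘ (id ⊗₁ unitorˡ⇐) ∘ unitorʳ⇐
      ≈⟨ refl⟩∘⟨ trans (pullˡ associator⇐-natural) assoc ⟩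
    (μ ⊗₁ id) ∘ ((id ⊗₁ p) ⊗₁ p) ∘ associator⇐ ∘ (id ⊗₁ unitorˡ⇐) ∘ unitorʳ⇐
      ≈⟨ refl⟩∘⟨ refl⟩∘⟨ pullˡ triangle-inverse ⟩
    (μ ⊗₁ id) ∘ ((id ⊗₁ p) ⊗₁ p) ∘ (unitorʳ⇐ ⊗₁ id) ∘ unitorʳ⇐
      ≈⟨ refl⟩∘⟨ pullˡ (sym ⊗-homomorphism) ⟩
    (μ ⊗₁ id) ∘ (((id ⊗₁ p) ∘ unitorʳ⇐) ⊗₁ (p ∘ id)) ∘ unitorʳ⇐
      ≈⟨ pullˡ (sym ⊗-homomorphism) ⟩
    (Phi V F p ⊗₁ (id ∘ p ∘ id)) ∘ unitorʳ⇐
      ≈⟨ ⊗-resp-≈ refl (trans identityˡ identityʳ) ⟩∘⟨refl ⟩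
    (Phi V F p ⊗₁ p) ∘ unitorʳ⇐ ∎

  Phi-copyable-factors : ∀ {p} → Copyable p →
                         Phi V F p ≈ unitorˡ⇒ ∘ ((ε ∘ Phi V F p) ⊗₁ p) ∘ unitorʳ⇐
  Phi-copyable-factors {p} δp = begin
    Φp                                              ≈⟨ identityˡ ⟨
    id ∘ Φp                                         ≈⟨ trans (refl⟩∘⟨ δ-counitˡ) unitorˡ-isoʳ ⟩∘⟨refl ⟨
    (unitorˡ⇒ ∘ (ε ⊗₁ id) ∘ δ) ∘ Φp                 ≈⟨ trans assoc (refl⟩∘⟨ assoc) ⟩
    unitorˡ⇒ ∘ (ε ⊗₁ id) ∘ δ ∘ Φp                   ≈⟨ refl⟩∘⟨ refl⟩∘⟨ δ∘Phi-copyable δp ⟩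
    unitorˡ⇒ ∘ (ε ⊗₁ id) ∘ (Φp ⊗₁ p) ∘ unitorʳ⇐     ≈⟨ refl⟩∘⟨ pullˡ (sym ⊗-homomorphism) ⟩
    unitorˡ⇒ ∘ ((ε ∘ Φp) ⊗₁ (id ∘ p)) ∘ unitorʳ⇐    ≈⟨ refl⟩∘⟨ ⊗-resp-≈ refl identityˡ ⟩∘⟨refl ⟩
    unitorˡ⇒ ∘ ((ε ∘ Φp) ⊗₁ p) ∘ unitorʳ⇐           ∎
    where
    Φp : Q ⇒ Q
    Φp = Phi V F p

  Phi-copyable-point : ∀ {p} → Copyable p → (x : unit ⇒ Q) →
                       Phi V F p ∘ x ≈ scalarMul V (ε ∘ Phi V F p ∘ x) p
  Phi-copyable-point {p} δp x = begin
    Φp ∘ x                                           ≈⟨ Phi-copyable-factors δp ⟩∘⟨refl ⟩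
    (unitorˡ⇒ ∘ ((ε ∘ Φp) ⊗₁ p) ∘ unitorʳ⇐) ∘ x      ≈⟨ trans assoc (refl⟩∘⟨ assoc) ⟩
    unitorˡ⇒ ∘ ((ε ∘ Φp) ⊗₁ p) ∘ unitorʳ⇐ ∘ x        ≈⟨ refl⟩∘⟨ refl⟩∘⟨ unitorʳ⇐-natural ⟩
    unitorˡ⇒ ∘ ((ε ∘ Φp) ⊗₁ p) ∘ (x ⊗₁ id) ∘ unitorʳ⇐ ≈⟨ refl⟩∘⟨ pullˡ (sym ⊗-homomorphism) ⟩
    unitorˡ⇒ ∘ (((ε ∘ Φp) ∘ x) ⊗₁ (p ∘ id)) ∘ unitorʳ⇐
      ≈⟨ refl⟩∘⟨ ⊗-resp-≈ assoc identityʳ ⟩∘⟨ sym unitorˡ⇐≈unitorʳ⇐ ⟩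
    unitorˡ⇒ ∘ ((ε ∘ Φp ∘ x) ⊗₁ p) ∘ unitorˡ⇐        ∎
    where
    Φp : Q ⇒ Q
    Φp = Phi V F p

module TauCounit {o ℓ e : Level} (V : SymmetricMonoidalCategory o ℓ e)
                 {Q : SymmetricMonoidalCategory.Obj V} (A B : CFA V Q) where
  open SymmetricMonoidalCategory V
  open MonoidalCoherence V
  open HomReasoning
  private
    module A = CFA A
    module B = CFA B

  discard-copied-unit : (id ⊗₁ A.ε) ∘ A.δ ∘ A.η ≈ (A.η ⊗₁ id) ∘ unitorˡ⇐
  discard-copied-unit = begin
    (id ⊗₁ A.ε) ∘ A.δ ∘ A.η ≈⟨ pullˡ A.δ-counitʳ ⟩
    unitorʳ⇐ ∘ A.η          ≈⟨ unitorʳ⇐-natural ⟩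
    (A.η ⊗₁ id) ∘ unitorʳ⇐  ≈⟨ refl⟩∘⟨ unitorˡ⇐≈unitorʳ⇐ ⟨
    (A.η ⊗₁ id) ∘ unitorˡ⇐  ∎

  counit∘tau : A.ε ∘ tau V A B ≈ B.ε ∘ Phi V B A.η
  counit∘tau = begin
    A.ε ∘ unitorˡ⇒ ∘ (h ⊗₁ id) ∘ associator⇐ ∘ (id ⊗₁ (A.δ ∘ A.η)) ∘ unitorʳ⇐
      ≈⟨ trans (pullˡ (sym unitorˡ-natural)) assoc ⟩
    unitorˡ⇒ ∘ (id ⊗₁ A.ε) ∘ (h ⊗₁ id) ∘ associator⇐ ∘ (id ⊗₁ (A.δ ∘ A.η)) ∘ unitorʳ⇐
      ≈⟨ refl⟩∘⟨ trans (pullˡ id⊗-⊗id-commute) assoc ⟩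
    unitorˡ⇒ ∘ (h ⊗₁ id) ∘ (id ⊗₁ A.ε) ∘ associator⇐ ∘ (id ⊗₁ (A.δ ∘ A.η)) ∘ unitorʳ⇐
      ≈⟨ refl⟩∘⟨ refl⟩∘⟨ trans (pullˡ ε-past-associator) assoc ⟩
    unitorˡ⇒ ∘ (h ⊗₁ id) ∘ associator⇐ ∘ (id ⊗₁ (id ⊗₁ A.ε)) ∘ (id ⊗₁ (A.δ ∘ A.η)) ∘ unitorʳ⇐
      ≈⟨ refl⟩∘⟨ refl⟩∘⟨ refl⟩∘⟨ pullˡ (sym id⊗-homomorphism) ⟩
    unitorˡ⇒ ∘ (h ⊗₁ id) ∘ associator⇐ ∘ (id ⊗₁ ((id ⊗₁ A.ε) ∘ A.δ ∘ A.η)) ∘ unitorʳ⇐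
      ≈⟨ refl⟩∘⟨ refl⟩∘⟨ refl⟩∘⟨ ⊗-resp-≈ refl discard-copied-unit ⟩∘⟨refl ⟩
    unitorˡ⇒ ∘ (h ⊗₁ id) ∘ associator⇐ ∘ (id ⊗₁ ((A.η ⊗₁ id) ∘ unitorˡ⇐)) ∘ unitorʳ⇐
      ≈⟨ contract-through-unit ⟩
    (B.ε ∘ B.μ) ∘ (id ⊗₁ A.η) ∘ unitorʳ⇐
      ≈⟨ assoc ⟩
    B.ε ∘ Phi V B A.η ∎
    where
    h : (Q ⊗₀ Q) ⇒ unit
    h = B.ε ∘ B.μ
    ε-past-associator : (id ⊗₁ A.ε) ∘ associator⇐ ≈ associator⇐ ∘ (id ⊗₁ (id ⊗₁ A.ε))
    ε-past-associator = trans (⊗-resp-≈ (sym ⊗-identity) refl ⟩∘⟨refl) (sym associator⇐-natural)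

theorem3p2 : ∀ {o ℓ e : Level} (V : SymmetricMonoidalCategory o ℓ e) →
    let open SymmetricMonoidalCategory V in
    ∀ {Q : Obj} (G W : CFA V Q) → GHZWPair V G W →
    PluggingSet₂ V (CFA.η W) (tau V G W ∘ CFA.η W) →
    (ψ : unit ⇒ Q) →
    Phi V G ψ ∘ CFA.η W ≈ scalarMul V (CFA.ε W ∘ tau V G W ∘ ψ) (CFA.η W)
theorem3p2 V G W pair _ ψ = begin
  Phi V G ψ ∘ W.η                         ≈⟨ Phi-points-commute ⟩
  Phi V G W.η ∘ ψ                         ≈⟨ Phi-copyable-point pair-β ψ ⟩
  scalarMul V (G.ε ∘ Phi V G W.η ∘ ψ) W.η ≈⟨ scalarMul-resp-≈ scalars ⟩
  scalarMul V (W.ε ∘ tau V G W ∘ ψ) W.η   ∎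
  where
  open SymmetricMonoidalCategory V
  open MonoidalCoherence V
  open HomReasoning
  open MultiplicationByPoint V G
  open TauCounit V W G
  open GHZWPair pair
  module G = CFA G
  module W = CFA W

  scalars : G.ε ∘ Phi V G W.η ∘ ψ ≈ W.ε ∘ tau V G W ∘ ψ
  scalars = begin
    G.ε ∘ Phi V G W.η ∘ ψ   ≈⟨ assoc ⟨
    (G.ε ∘ Phi V G W.η) ∘ ψ ≈⟨ counit∘tau ⟩∘⟨refl ⟨
    (W.ε ∘ tau V W G) ∘ ψ   ≈⟨ assoc ⟩
    W.ε ∘ tau V W G ∘ ψ     ≈⟨ refl⟩∘⟨ pair-α ⟩∘⟨refl ⟨
    W.ε ∘ tau V G W ∘ ψ     ∎
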